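{- For every integer $k\ge2$, $\kappa_i(C_{3k}^{(3)}-e)=0$ for $i<2k$, and \[ \kappa_{2k+i}(C_{3k}^{(3)}-e)=\binom{k+2i-1}{3i}\quad\text{for }0\le i\le k-1. \]
   Context: The tight cycle $C_\ell^{(3)}$ ($\ell>3$) is the $3$-graph with vertex set $\{1,\dots,\ell\}$ and edges $\{i,i+1,i+2\}$ ($i=1,\dots,\ell$, addition mod $\ell$); $C_\ell^{(3)}-e$ is obtained by deleting one edge. For a $3$-graph $H$, $\kappa_m(H)$ is the number of subsets of $E(H)$ of size $m$ such that, in the subgraph formed by those edges, no vertex has degree exactly one. -}

module Defs where

open import Data.Nat using (ℕ; zero; suc; _+_; _∸_; _≡ᵇ_)
open import Data.Bool using (Bool; true; false; _∨_; _∧_)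
open import Data.Fin using (Fin; toℕ)
open import Data.Fin.Subset using (Subset; _∈_; ∣_∣)
open import Data.Fin.Properties using (all?)
open import Data.Fin.Subset.Properties using (_∈?_)
open import Data.Vec using (Vec; []; _∷_; tabulate)
open import Data.List using (List; []; _∷_; _++_; map; filter; length)
open import Data.Product using (_×_)
open import Relation.Binary.PropositionalEquality using (_≡_)
open import Relation.Nullary using (¬_; Dec; does)
open import Relation.Nullary.Decidable using (_×-dec_; ¬?)
open import Data.Nat.Properties using (_≟_)

Hypergraph : ℕ → ℕ → Set
Hypergraph n e = Fin e → Subset n

allSubsets : (e : ℕ) → List (Subset e)
allSubsets zero = [] ∷ []
allSubsets (suc e) = map (true ∷_) (allSubsets e) ++ map (false ∷_) (allSubsets e)

degree : ∀ {n e} → Hypergraph n e → Subset e → Fin n → ℕ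
degree {n} {e} H S v = ∣ tabulate (λ i → inSub i) ∣
  where
  inSub : Fin e → Bool
  inSub i = does (i ∈? S) ∧ does (v ∈? H i)

Counted : ∀ {n e} → Hypergraph n e → ℕ → Subset e → Set
Counted {n} H m S = (∣ S ∣ ≡ m) × (∀ (v : Fin n) → ¬ (degree H S v ≡ 1))

Counted? : ∀ {n e} (H : Hypergraph n e) (m : ℕ) (S : Subset e) → Dec (Counted H m S)
Counted? H m S = (∣ S ∣ ≟ m) ×-dec all? (λ v → ¬? (degree H S v ≟ 1))

κ : ∀ {n e} → Hypergraph n e → ℕ → ℕ
κ {e = e} H m = length (filter (Counted? H m) (allSubsets e))

-- Is vertex v (in Fin ℓ) equal to a + t modulo ℓ, for a + t < 2ℓ?
≡modᵇ : (ℓ : ℕ) → ℕ → ℕ → Bool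
≡modᵇ ℓ v x = (v ≡ᵇ x) ∨ ((v + ℓ) ≡ᵇ x)

tightEdge : (ℓ : ℕ) → ℕ → Subset ℓ
tightEdge ℓ a = tabulate (λ v → ≡modᵇ ℓ (toℕ v) a ∨ (≡modᵇ ℓ (toℕ v) (a + 1) ∨ ≡modᵇ ℓ (toℕ v) (a + 2)))

tightCycle : (ℓ : ℕ) → Hypergraph ℓ ℓ
tightCycle ℓ i = tightEdge ℓ (toℕ i)

-- C_ℓ^(3) - e : delete the edge {ℓ-1, 0, 1}; remaining edges {a,a+1,a+2}, a = 0..ℓ-2.
-- (All single-edge deletions are isomorphic by rotation.)
tightCycleMinusEdge : (ℓ : ℕ) → Hypergraph ℓ (ℓ ∸ 1)
tightCycleMinusEdge ℓ i = tightEdge ℓ (toℕ i)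

-- Label the edges of C_{ℓ}^{(3)} − e by their first vertex 0, …, ℓ−2, so that an edge set is a
-- binary word of length ℓ−1. Vertex t ≥ 1 lies in the consecutive edges t−2, t−1, t, and
-- vertex 0 in the first and the last edge. Hence no vertex has degree one iff every window of
-- three consecutive letters avoids the sum 1 and the first and last letters agree; apart from
-- the empty set these words are 1^{a₁} 0 1^{a₂} 0 ⋯ 0 1^{a_r} with all aᵢ ≥ 2. A finite automaton
-- recognises them, and counting accepted words by length and number of ones gives a Pascal
-- recurrence: after the leading 11, a word with j zeros and 2j + r ones is a run 1^b followed
-- by j blocks 0 1^{a} (a ≥ 2), so there are C(j + r, r) of them, and none when there are fewer
-- than two ones per zero.
module Submission where

open import Data.Bool using (Bool; true; false; _∧_; _∨_; if_then_else_)
open import Data.Bool.Properties using (∧-zeroʳ; ∨-identityʳ)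
open import Data.Fin using (Fin; zero; suc; toℕ)
import Data.Fin.Properties as Fin
open import Data.Fin.Subset using (Subset; ∣_∣)
open import Data.Fin.Subset.Properties using (_∈?_)
open import Data.List using (List; []; _∷_; _++_; map; filter; length)
open import Data.List.Properties using (filter-++; length-++)
open import Data.Nat using (ℕ; zero; suc; _+_; _*_; _∸_; _≤_; _<_; _≡ᵇ_; s≤s; s≤s⁻¹; z<s)
open import Data.Nat.Properties
  using (_≟_; +-identityʳ; +-suc; +-comm; *-suc; >⇒≢; m≤m+n; m<n+m; n<1+n; n≤1+n; m<n⇒m<1+n;
         +-mono-≤; +-monoˡ-≤; +-monoʳ-≤; ≤-trans; ≤-reflexive; m≤n⇒∃[o]m+o≡n; module ≤-Reasoning)
open import Data.Nat.Combinatorics using (_C_; nCn≡1; nCk+nC[k+1]≡[n+1]C[k+1])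
open import Data.Nat.Tactic.RingSolver using (solve-∀)
open import Data.Product using (Σ; _×_; _,_)
open import Data.Vec using (Vec; []; _∷_; lookup; tabulate; last)
open import Data.Vec.Properties using (lookup∘tabulate)
open import Data.Vec.Relation.Unary.All using (All; all?)
open import Data.Vec.Relation.Unary.All.Properties using (lookup⁺; lookup⁻)
open import Function using (_∘_; _⇔_; mk⇔)
open import Relation.Binary.PropositionalEquality
open import Relation.Nullary using (Dec; does; ¬?)
open import Relation.Nullary.Decidable using (dec-false; does-⇔)

open import Defs

private
  variable
    n : ℕ

bit : Bool → ℕ
bit false = 0
bit true  = 1

countVecs : (e : ℕ) → (Vec Bool e → Bool) → ℕ
countVecs zero    p = bit (p [])
countVecs (suc e) p = countVecs e (p ∘ (true ∷_)) + countVecs e (p ∘ (false ∷_))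

countVecs-cong : ∀ e {p q : Vec Bool e → Bool} → (∀ x → p x ≡ q x) → countVecs e p ≡ countVecs e q
countVecs-cong zero    p≗q = cong bit (p≗q [])
countVecs-cong (suc e) p≗q =
  cong₂ _+_ (countVecs-cong e (p≗q ∘ (true ∷_))) (countVecs-cong e (p≗q ∘ (false ∷_)))

countVecs-false : ∀ e → countVecs e (λ _ → false) ≡ 0
countVecs-false zero    = refl
countVecs-false (suc e) = cong₂ _+_ (countVecs-false e) (countVecs-false e)

length-filter-map : ∀ {A B : Set} {P : B → Set} (P? : ∀ y → Dec (P y)) (f : A → B) (xs : List A) →
                    length (filter P? (map f xs)) ≡ length (filter (P? ∘ f) xs)
length-filter-map P? f []       = refl
length-filter-map P? f (x ∷ xs) with does (P? (f x))
... | true  = cong suc (length-filter-map P? f xs)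
... | false = length-filter-map P? f xs

length-filter-allSubsets : ∀ e {P : Subset e → Set} (P? : ∀ S → Dec (P S)) →
                           length (filter P? (allSubsets e)) ≡ countVecs e (does ∘ P?)
length-filter-allSubsets zero P? with does (P? [])
... | true  = refl
... | false = refl
length-filter-allSubsets (suc e) P? = begin
  length (filter P? (withTrue ++ withFalse))
    ≡⟨ cong length (filter-++ P? withTrue withFalse) ⟩
  length (filter P? withTrue ++ filter P? withFalse)
    ≡⟨ length-++ (filter P? withTrue) ⟩
  length (filter P? withTrue) + length (filter P? withFalse)
    ≡⟨ cong₂ _+_ (trans (length-filter-map P? (true ∷_) (allSubsets e))
                        (length-filter-allSubsets e (P? ∘ (true ∷_))))
                 (trans (length-filter-map P? (false ∷_) (allSubsets e))
                        (length-filter-allSubsets e (P? ∘ (false ∷_)))) ⟩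
  countVecs (suc e) (does ∘ P?) ∎
  where
  open ≡-Reasoning
  withTrue withFalse : List (Subset (suc e))
  withTrue  = map (true ∷_) (allSubsets e)
  withFalse = map (false ∷_) (allSubsets e)

countOnesAt : Vec Bool n → (Fin n → Bool) → ℕ
countOnesAt []      p = 0
countOnesAt (b ∷ x) p = (if p zero then bit b else 0) + countOnesAt x (p ∘ suc)

countOnesAt-cong : (x : Vec Bool n) {p q : Fin n → Bool} → (∀ i → p i ≡ q i) →
                   countOnesAt x p ≡ countOnesAt x q
countOnesAt-cong []      p≗q = refl
countOnesAt-cong (b ∷ x) p≗q =
  cong₂ _+_ (cong (λ c → if c then bit b else 0) (p≗q zero)) (countOnesAt-cong x (p≗q ∘ suc))

countOnesAt-false : (x : Vec Bool n) → countOnesAt x (λ _ → false) ≡ 0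
countOnesAt-false []      = refl
countOnesAt-false (_ ∷ x) = countOnesAt-false x

countOnesAt-false∷ : (x : Vec Bool n) (p : Fin (suc n) → Bool) →
                     countOnesAt (false ∷ x) p ≡ countOnesAt x (p ∘ suc)
countOnesAt-false∷ x p with p zero
... | true  = refl
... | false = refl

does-∈? : (i : Fin n) (S : Subset n) → does (i ∈? S) ≡ lookup S i
does-∈? zero    (true ∷ S)  = refl
does-∈? zero    (false ∷ S) = refl
does-∈? (suc i) (_ ∷ S)     = does-∈? i S

∣tabulate-∈?∣ : (S : Subset n) (q : Fin n → Bool) → ∣ tabulate (λ i → does (i ∈? S) ∧ q i) ∣ ≡ countOnesAt S q
∣tabulate-∈?∣ []          q = refl
∣tabulate-∈?∣ (true ∷ S)  q with q zero
... | true  = cong suc (∣tabulate-∈?∣ S (q ∘ suc))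
... | false = ∣tabulate-∈?∣ S (q ∘ suc)
∣tabulate-∈?∣ (false ∷ S) q with q zero
... | true  = ∣tabulate-∈?∣ S (q ∘ suc)
... | false = ∣tabulate-∈?∣ S (q ∘ suc)

windowSums : Bool → Bool → Vec Bool n → Vec ℕ (suc n)
windowSums a b []      = bit a + bit b ∷ []
windowSums a b (c ∷ x) = bit a + (bit b + bit c) ∷ windowSums b c x

degreeSequence : Vec Bool (2 + n) → Vec ℕ (3 + n)
degreeSequence (c ∷ x) = bit c + bit (last (c ∷ x)) ∷ windowSums false c x

inTightEdge : (ℓ t a : ℕ) → Bool
inTightEdge ℓ t a = ≡modᵇ ℓ t a ∨ (≡modᵇ ℓ t (a + 1) ∨ ≡modᵇ ℓ t (a + 2))

inTightPathEdge : (t a : ℕ) → Bool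
inTightPathEdge t a = (t ≡ᵇ a) ∨ ((t ≡ᵇ a + 1) ∨ (t ≡ᵇ a + 2))

does-∈?-tightEdge : ∀ ℓ a (v : Fin ℓ) → does (v ∈? tightEdge ℓ a) ≡ inTightEdge ℓ (toℕ v) a
does-∈?-tightEdge ℓ a v = trans (does-∈? v (tightEdge ℓ a)) (lookup∘tabulate _ v)

≡modᵇ-< : ∀ ℓ t x → x < t + ℓ → ≡modᵇ ℓ t x ≡ (t ≡ᵇ x)
≡modᵇ-< ℓ t x x<t+ℓ = trans (cong ((t ≡ᵇ x) ∨_) (dec-false (t + ℓ ≟ x) (>⇒≢ x<t+ℓ))) (∨-identityʳ _)

inTightEdge-suc : ∀ {n t a} → a < 2 + n → inTightEdge (3 + n) (suc t) a ≡ inTightPathEdge (suc t) a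
inTightEdge-suc {n} {t} {a} a<2+n =
  cong₂ _∨_ (≡modᵇ-< (3 + n) (suc t) a a<)
            (cong₂ _∨_ (≡modᵇ-< (3 + n) (suc t) (a + 1) a+1<) (≡modᵇ-< (3 + n) (suc t) (a + 2) a+2<))
  where
  open ≤-Reasoning
  a+2< : a + 2 < suc t + (3 + n)
  a+2< = begin-strict
    a + 2      ≤⟨ +-monoˡ-≤ 2 (s≤s⁻¹ a<2+n) ⟩
    suc n + 2  ≡⟨ +-comm (suc n) 2 ⟩
    3 + n      <⟨ m<n+m (3 + n) z<s ⟩
    suc t + (3 + n) ∎
  a+1< : a + 1 < suc t + (3 + n)
  a+1< = ≤-trans (s≤s (+-monoʳ-≤ a (n≤1+n 1))) a+2<
  a< : a < suc t + (3 + n)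
  a< = ≤-trans (s≤s (m≤m+n a 2)) a+2<

inTightEdge-zero : ∀ {n a} → a < 2 + n → inTightEdge (3 + n) 0 a ≡ (0 ≡ᵇ a) ∨ (3 + n ≡ᵇ a + 2)
inTightEdge-zero {n} {a} a<2+n =
  cong₂ _∨_ (≡modᵇ-< (3 + n) 0 a (m<n⇒m<1+n a<2+n))
            (cong₂ _∨_ (trans (≡modᵇ-< (3 + n) 0 (a + 1) a+1<3+n) (cong (0 ≡ᵇ_) (+-comm a 1)))
                       (cong (_∨ (3 + n ≡ᵇ a + 2)) (cong (0 ≡ᵇ_) (+-comm a 2))))
  where
  a+1<3+n : a + 1 < 3 + n
  a+1<3+n = subst (_< 3 + n) (+-comm 1 a) (s≤s a<2+n)

windowSums-countOnesAt : (a b : Bool) (x : Vec Bool n) (t : Fin (suc n)) →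
                         lookup (windowSums a b x) t
                           ≡ countOnesAt (a ∷ b ∷ x) (inTightPathEdge (2 + toℕ t) ∘ toℕ)
windowSums-countOnesAt a b []      zero    = cong (bit a +_) (sym (+-identityʳ (bit b)))
windowSums-countOnesAt a b (c ∷ x) zero    =
  cong (λ z → bit a + (bit b + z)) (sym (trans (cong (bit c +_) (countOnesAt-false x)) (+-identityʳ (bit c))))
windowSums-countOnesAt a b (c ∷ x) (suc t) = windowSums-countOnesAt b c x t

countOnesAt-last : (y : Vec Bool (suc n)) → countOnesAt y (λ i → 2 + n ≡ᵇ toℕ i + 2) ≡ bit (last y)
countOnesAt-last {zero}  (c ∷ []) = +-identityʳ (bit c)
countOnesAt-last {suc n} (c ∷ y)  = countOnesAt-last y

countOnesAt-tightEdge : (S : Vec Bool (2 + n)) (v : Fin (3 + n)) →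
                        countOnesAt S (inTightEdge (3 + n) (toℕ v) ∘ toℕ) ≡ lookup (degreeSequence S) v
countOnesAt-tightEdge (c ∷ y) zero    =
  trans (countOnesAt-cong (c ∷ y) (λ i → inTightEdge-zero (Fin.toℕ<n i))) (cong (bit c +_) (countOnesAt-last y))
countOnesAt-tightEdge (c ∷ y) (suc t) =
  trans (countOnesAt-cong (c ∷ y) (λ i → inTightEdge-suc {t = toℕ t} (Fin.toℕ<n i)))
        (sym (trans (windowSums-countOnesAt false c y t)
                    (countOnesAt-false∷ (c ∷ y) (inTightPathEdge (2 + toℕ t) ∘ toℕ))))

degree-tightCycleMinusEdge : (S : Subset (2 + n)) (v : Fin (3 + n)) →
                             degree (tightCycleMinusEdge (3 + n)) S v ≡ lookup (degreeSequence S) v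
degree-tightCycleMinusEdge {n} S v = begin
  degree (tightCycleMinusEdge (3 + n)) S v
    ≡⟨ ∣tabulate-∈?∣ S (λ i → does (v ∈? tightEdge (3 + n) (toℕ i))) ⟩
  countOnesAt S (λ i → does (v ∈? tightEdge (3 + n) (toℕ i)))
    ≡⟨ countOnesAt-cong S (λ i → does-∈?-tightEdge (3 + n) (toℕ i) v) ⟩
  countOnesAt S (inTightEdge (3 + n) (toℕ v) ∘ toℕ)
    ≡⟨ countOnesAt-tightEdge S v ⟩
  lookup (degreeSequence S) v ∎
  where open ≡-Reasoning

-- After the first letter, a state remembers what still matters of the word read so far:
-- `allZero` if it began with 0 (then every later letter must be 0), otherwise whether it
-- ends in a run of exactly one 1 (`single`), in a run of at least two 1s (`run`), or in a
-- 0 that follows such a run (`gap`).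
data State : Set where
  start allZero single run gap dead : State

step : State → Bool → State
step start   true  = single
step start   false = allZero
step allZero true  = dead
step allZero false = allZero
step single  true  = run
step single  false = dead
step run     true  = run
step run     false = gap
step gap     true  = single
step gap     false = dead
step dead    _     = dead

final : State → Bool
final start   = true
final allZero = true
final single  = false
final run     = true
final gap     = false
final dead    = false

accepts : State → Vec Bool n → Bool
accepts s []      = final s
accepts s (b ∷ x) = accepts (step s b) x

accepts-dead : (x : Vec Bool n) → accepts dead x ≡ false
accepts-dead []      = refl
accepts-dead (_ ∷ x) = accepts-dead x

avoidsOne? : (ds : Vec ℕ n) → Dec (All (_≢ 1) ds)
avoidsOne? = all? (λ d → ¬? (d ≟ 1))

-- The degrees not yet determined after reading p letters, the first being `first` and the
-- last two `a b`: that of vertex 0, and those of the vertices p, p + 1, ….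
pendingDegrees : (first a b : Bool) → Vec Bool n → Vec ℕ (2 + n)
pendingDegrees first a b y = bit first + bit (last (b ∷ y)) ∷ windowSums a b y

accepts-allZero : (y : Vec Bool n) → accepts allZero y ≡ does (avoidsOne? (pendingDegrees false false false y))
accepts-single  : (y : Vec Bool n) → accepts single y ≡ does (avoidsOne? (pendingDegrees true false true y))
accepts-run     : (y : Vec Bool n) → accepts run y ≡ does (avoidsOne? (pendingDegrees true true true y))
accepts-gap     : (y : Vec Bool n) → accepts gap y ≡ does (avoidsOne? (pendingDegrees true true false y))

accepts-allZero []          = refl
accepts-allZero (false ∷ y) = accepts-allZero y
accepts-allZero (true ∷ y)  = trans (accepts-dead y) (sym (∧-zeroʳ _))
accepts-single  []          = refl
accepts-single  (true ∷ y)  = accepts-run y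
accepts-single  (false ∷ y) = trans (accepts-dead y) (sym (∧-zeroʳ _))
accepts-run     []          = refl
accepts-run     (true ∷ y)  = accepts-run y
accepts-run     (false ∷ y) = accepts-gap y
accepts-gap     []          = refl
accepts-gap     (true ∷ y)  = accepts-single y
accepts-gap     (false ∷ y) = trans (accepts-dead y) (sym (∧-zeroʳ _))

accepts-start : (S : Vec Bool (2 + n)) → accepts start S ≡ does (avoidsOne? (degreeSequence S))
accepts-start (true ∷ x)  = accepts-single x
accepts-start (false ∷ x) = accepts-allZero x

#accepted : State → (letters ones : ℕ) → ℕ
#accepted s zero    zero    = bit (final s)
#accepted s zero    (suc m) = 0
#accepted s (suc e) zero    = #accepted (step s false) e zero
#accepted s (suc e) (suc m) = #accepted (step s true) e m + #accepted (step s false) e (suc m)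

countVecs-accepts : ∀ s e m → countVecs e (λ x → (∣ x ∣ ≡ᵇ m) ∧ accepts s x) ≡ #accepted s e m
countVecs-accepts s zero    zero    = refl
countVecs-accepts s zero    (suc m) = refl
countVecs-accepts s (suc e) zero    =
  cong₂ _+_ (countVecs-false e) (countVecs-accepts (step s false) e zero)
countVecs-accepts s (suc e) (suc m) =
  cong₂ _+_ (countVecs-accepts (step s true) e m) (countVecs-accepts (step s false) e (suc m))

noDegreeOne⇔ : (S : Subset (2 + n)) →
               (∀ v → degree (tightCycleMinusEdge (3 + n)) S v ≢ 1) ⇔ All (_≢ 1) (degreeSequence S)
noDegreeOne⇔ S = mk⇔
  (λ noOne → lookup⁻ (λ v → noOne v ∘ trans (degree-tightCycleMinusEdge S v)))
  (λ all v → lookup⁺ all v ∘ trans (sym (degree-tightCycleMinusEdge S v)))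

does-Counted? : ∀ m (S : Subset (2 + n)) →
                does (Counted? (tightCycleMinusEdge (3 + n)) m S) ≡ (∣ S ∣ ≡ᵇ m) ∧ accepts start S
does-Counted? {n} m S = cong ((∣ S ∣ ≡ᵇ m) ∧_)
  (trans (does-⇔ (noDegreeOne⇔ S) noDegreeOne? (avoidsOne? (degreeSequence S))) (sym (accepts-start S)))
  where
  noDegreeOne? : Dec (∀ v → degree (tightCycleMinusEdge (3 + n)) S v ≢ 1)
  noDegreeOne? = Fin.all? λ v → ¬? (degree (tightCycleMinusEdge (3 + n)) S v ≟ 1)

κ-tightCycleMinusEdge : ∀ n m → κ (tightCycleMinusEdge (3 + n)) m ≡ #accepted start (2 + n) m
κ-tightCycleMinusEdge n m = begin
  κ (tightCycleMinusEdge (3 + n)) m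
    ≡⟨ length-filter-allSubsets (2 + n) (Counted? (tightCycleMinusEdge (3 + n)) m) ⟩
  countVecs (2 + n) (does ∘ Counted? (tightCycleMinusEdge (3 + n)) m)
    ≡⟨ countVecs-cong (2 + n) (does-Counted? m) ⟩
  countVecs (2 + n) (λ S → (∣ S ∣ ≡ᵇ m) ∧ accepts start S)
    ≡⟨ countVecs-accepts start (2 + n) m ⟩
  #accepted start (2 + n) m ∎
  where open ≡-Reasoning

κ-tightCycleMinusEdge-3[1+k] : ∀ k m → κ (tightCycleMinusEdge (3 * suc k)) m ≡ #accepted start (2 + 3 * k) m
κ-tightCycleMinusEdge-3[1+k] k m =
  trans (cong (λ ℓ → κ (tightCycleMinusEdge ℓ) m) (*-suc 3 k)) (κ-tightCycleMinusEdge (3 * k) m)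

#accepted-dead : ∀ e m → #accepted dead e m ≡ 0
#accepted-dead zero    zero    = refl
#accepted-dead zero    (suc m) = refl
#accepted-dead (suc e) zero    = #accepted-dead e zero
#accepted-dead (suc e) (suc m) = cong₂ _+_ (#accepted-dead e m) (#accepted-dead e (suc m))

#accepted-> : ∀ s {e m} → e < m → #accepted s e m ≡ 0
#accepted-> s {zero}  {suc m} _       = refl
#accepted-> s {suc e} {suc m} 1+e<1+m =
  cong₂ _+_ (#accepted-> (step s true) e<m) (#accepted-> (step s false) (m<n⇒m<1+n e<m))
  where
  e<m : e < m
  e<m = s≤s⁻¹ 1+e<1+m

#accepted-allZero : ∀ e m → #accepted allZero e (suc m) ≡ 0
#accepted-allZero zero    m = refl
#accepted-allZero (suc e) m = cong₂ _+_ (#accepted-dead e m) (#accepted-allZero e m)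

#accepted-single-noOnes : ∀ e → #accepted single e 0 ≡ 0
#accepted-single-noOnes zero    = refl
#accepted-single-noOnes (suc e) = #accepted-dead e 0

#accepted-gap-noOnes : ∀ e → #accepted gap e 0 ≡ 0
#accepted-gap-noOnes zero    = refl
#accepted-gap-noOnes (suc e) = #accepted-dead e 0

#accepted-start-one : ∀ e → #accepted start (2 + e) 1 ≡ 0
#accepted-start-one e = cong₂ _+_ (#accepted-dead e 0) (#accepted-allZero (suc e) 0)

#accepted-start-step : ∀ e m → #accepted start (2 + e) (2 + m) ≡ #accepted run e m
#accepted-start-step e m = begin
  (#accepted run e m + #accepted dead e (1 + m)) + #accepted allZero (1 + e) (2 + m)
    ≡⟨ cong₂ _+_ (cong (#accepted run e m +_) (#accepted-dead e (1 + m))) (#accepted-allZero (1 + e) (1 + m)) ⟩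
  (#accepted run e m + 0) + 0
    ≡⟨ trans (+-identityʳ _) (+-identityʳ _) ⟩
  #accepted run e m ∎
  where open ≡-Reasoning

#accepted-run-step : ∀ e m → #accepted run (3 + e) (2 + m) ≡ #accepted run (2 + e) (1 + m) + #accepted run e m
#accepted-run-step e m = cong (#accepted run (2 + e) (1 + m) +_) (begin
  (#accepted run e m + #accepted dead e (1 + m)) + #accepted dead (1 + e) (2 + m)
    ≡⟨ cong₂ _+_ (cong (#accepted run e m +_) (#accepted-dead e (1 + m))) (#accepted-dead (1 + e) (2 + m)) ⟩
  (#accepted run e m + 0) + 0
    ≡⟨ trans (+-identityʳ _) (+-identityʳ _) ⟩
  #accepted run e m ∎)
  where open ≡-Reasoning

#accepted-run-all : ∀ m → #accepted run m m ≡ 1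
#accepted-run-all zero    = refl
#accepted-run-all (suc m) = cong₂ _+_ (#accepted-run-all m) (#accepted-> gap (n<1+n m))

#accepted-run-sparse : ∀ m j → m < j + j → #accepted run (m + j) m ≡ 0
#accepted-run-sparse zero          (suc j) _ = #accepted-gap-noOnes j
#accepted-run-sparse (suc zero)    (suc j) _ =
  cong₂ _+_ (#accepted-gap-noOnes j) (cong₂ _+_ (#accepted-single-noOnes j) (#accepted-dead j 1))
#accepted-run-sparse (suc (suc m)) (suc j) 2+m<2+2j = begin
  #accepted run (2 + m + suc j) (2 + m)
    ≡⟨ cong (λ e → #accepted run (2 + e) (2 + m)) (+-suc m j) ⟩
  #accepted run (3 + (m + j)) (2 + m)
    ≡⟨ #accepted-run-step (m + j) m ⟩
  #accepted run (2 + (m + j)) (1 + m) + #accepted run (m + j) m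
    ≡⟨ cong₂ _+_ (trans (cong (λ e → #accepted run (suc e) (1 + m)) (sym (+-suc m j)))
                        (#accepted-run-sparse (suc m) (suc j) (≤-trans (n≤1+n _) 2+m<2+2j)))
                 (#accepted-run-sparse m j (s≤s⁻¹ (subst (2 + m ≤_) (+-suc j j) (s≤s⁻¹ 2+m<2+2j)))) ⟩
  0 ∎
  where open ≡-Reasoning

*-suc-+ : ∀ k j x → k * suc j + x ≡ k + (k * j + x)
*-suc-+ = solve-∀

#accepted-run-binomial : ∀ j r → #accepted run (3 * j + r) (2 * j + r) ≡ (j + r) C r
#accepted-run-binomial zero    r       = trans (#accepted-run-all r) (sym (nCn≡1 r))
#accepted-run-binomial (suc j) zero    = begin
  #accepted run (3 * suc j + 0) (2 * suc j + 0)
    ≡⟨ cong₂ (#accepted run) (*-suc-+ 3 j 0) (*-suc-+ 2 j 0) ⟩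
  #accepted run (3 + (3 * j + 0)) (2 + (2 * j + 0))
    ≡⟨ #accepted-run-step (3 * j + 0) (2 * j + 0) ⟩
  #accepted run (2 + (3 * j + 0)) (1 + (2 * j + 0)) + #accepted run (3 * j + 0) (2 * j + 0)
    ≡⟨ cong₂ _+_ (trans (cong (λ e → #accepted run e (1 + (2 * j + 0))) (zeros j))
                        (#accepted-run-sparse (1 + (2 * j + 0)) (suc j) (≤-reflexive (ones j))))
                 (#accepted-run-binomial j zero) ⟩
  (suc j + 0) C 0 ∎
  where
  open ≡-Reasoning
  zeros : ∀ j → 2 + (3 * j + 0) ≡ 1 + (2 * j + 0) + suc j
  zeros = solve-∀
  ones : ∀ j → 2 + (2 * j + 0) ≡ suc j + suc j
  ones = solve-∀
#accepted-run-binomial (suc j) (suc r) = begin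
  #accepted run (3 * suc j + suc r) (2 * suc j + suc r)
    ≡⟨ cong₂ (#accepted run) (*-suc-+ 3 j (suc r)) (*-suc-+ 2 j (suc r)) ⟩
  #accepted run (3 + (3 * j + suc r)) (2 + (2 * j + suc r))
    ≡⟨ #accepted-run-step (3 * j + suc r) (2 * j + suc r) ⟩
  #accepted run (2 + (3 * j + suc r)) (1 + (2 * j + suc r)) + #accepted run (3 * j + suc r) (2 * j + suc r)
    ≡⟨ cong₂ _+_ (trans (cong₂ (#accepted run) (sym (three′ j r)) (sym (two′ j r)))
                        (#accepted-run-binomial (suc j) r))
                 (#accepted-run-binomial j (suc r)) ⟩
  (suc j + r) C r + (j + suc r) C suc r
    ≡⟨ cong (λ n → (suc j + r) C r + n C suc r) (+-suc j r) ⟩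
  (suc j + r) C r + (suc j + r) C suc r
    ≡⟨ nCk+nC[k+1]≡[n+1]C[k+1] (suc j + r) r ⟩
  suc (suc j + r) C suc r
    ≡⟨ cong (_C suc r) (sym (+-suc (suc j) r)) ⟩
  (suc j + suc r) C suc r ∎
  where
  open ≡-Reasoning
  three′ : ∀ j r → 3 * suc j + r ≡ 2 + (3 * j + suc r)
  three′ = solve-∀
  two′ : ∀ j r → 2 * suc j + r ≡ 1 + (2 * j + suc r)
  two′ = solve-∀

m<2k⇒∃[j]m+j≡3k×m<j+j : ∀ {m k} → m < 2 * k → Σ ℕ λ j → m + j ≡ 3 * k × m < j + j
m<2k⇒∃[j]m+j≡3k×m<j+j {m} {k} m<2k with d , 1+m+d≡2k ← m≤n⇒∃[o]m+o≡n m<2k =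
  k + suc d , trans (regroup m k d) (cong (k +_) 1+m+d≡2k) , (begin
    suc m                   ≤⟨ m≤m+n (suc m) d ⟩
    suc m + d               ≡⟨ trans 1+m+d≡2k (double k) ⟩
    k + k                   ≤⟨ +-mono-≤ (m≤m+n k (suc d)) (m≤m+n k (suc d)) ⟩
    k + suc d + (k + suc d) ∎)
  where
  open ≤-Reasoning
  regroup : ∀ m k d → m + (k + suc d) ≡ k + (suc m + d)
  regroup = solve-∀
  double : ∀ k → 2 * k ≡ k + k
  double = solve-∀

κ-vanishes : ∀ k i → 1 ≤ i → i < 2 * suc k → κ (tightCycleMinusEdge (3 * suc k)) i ≡ 0
κ-vanishes k 1             _ _ = trans (κ-tightCycleMinusEdge-3[1+k] k 1) (#accepted-start-one (3 * k))
κ-vanishes k (suc (suc m)) _ 2+m<2[1+k]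
  with j , m+j≡3k , m<j+j
     ← m<2k⇒∃[j]m+j≡3k×m<j+j {k = k} (s≤s⁻¹ (s≤s⁻¹ (subst (3 + m ≤_) (*-suc 2 k) 2+m<2[1+k])))
     = begin
  κ (tightCycleMinusEdge (3 * suc k)) (2 + m) ≡⟨ κ-tightCycleMinusEdge-3[1+k] k (2 + m) ⟩
  #accepted start (2 + 3 * k) (2 + m)         ≡⟨ #accepted-start-step (3 * k) m ⟩
  #accepted run (3 * k) m                     ≡⟨ cong (λ e → #accepted run e m) m+j≡3k ⟨
  #accepted run (m + j) m                     ≡⟨ #accepted-run-sparse m j m<j+j ⟩
  0                                           ∎
  where open ≡-Reasoning

κ-binomial : ∀ k i → i ≤ k →
             κ (tightCycleMinusEdge (3 * suc k)) (2 * suc k + i) ≡ (suc k + 2 * i ∸ 1) C (3 * i)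
κ-binomial k i i≤k with j , refl ← m≤n⇒∃[o]m+o≡n i≤k = begin
  κ (tightCycleMinusEdge (3 * suc (i + j))) (2 * suc (i + j) + i)
    ≡⟨ κ-tightCycleMinusEdge-3[1+k] (i + j) _ ⟩
  #accepted start (2 + 3 * (i + j)) (2 * suc (i + j) + i)
    ≡⟨ cong₂ (#accepted start) (cong (2 +_) (length≡ i j)) (ones≡ i j) ⟩
  #accepted start (2 + (3 * j + 3 * i)) (2 + (2 * j + 3 * i))
    ≡⟨ #accepted-start-step (3 * j + 3 * i) (2 * j + 3 * i) ⟩
  #accepted run (3 * j + 3 * i) (2 * j + 3 * i)
    ≡⟨ #accepted-run-binomial j (3 * i) ⟩
  (j + 3 * i) C (3 * i)
    ≡⟨ cong (_C (3 * i)) (top≡ i j) ⟩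
  (suc (i + j) + 2 * i ∸ 1) C (3 * i) ∎
  where
  open ≡-Reasoning
  length≡ : ∀ i j → 3 * (i + j) ≡ 3 * j + 3 * i
  length≡ = solve-∀
  ones≡ : ∀ i j → 2 * suc (i + j) + i ≡ 2 + (2 * j + 3 * i)
  ones≡ = solve-∀
  top≡ : ∀ i j → j + 3 * i ≡ i + j + 2 * i
  top≡ = solve-∀

lemma3p7 : (k : ℕ) → 2 ≤ k →
    ((i : ℕ) → 1 ≤ i → i < 2 * k → κ (tightCycleMinusEdge (3 * k)) i ≡ 0)
    × ((i : ℕ) → i ≤ k ∸ 1 → κ (tightCycleMinusEdge (3 * k)) (2 * k + i) ≡ (k + 2 * i ∸ 1) C (3 * i))
lemma3p7 (suc k) _ = κ-vanishes k , κ-binomial k
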